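{- For every integer $n\ge 3$ and every positive integer $m$, the $m$-th line digraph $L^m(D_n^3)$ of the windmill digraph $D_n^3$ is a DNA graph.
   Context: All digraphs are finite. For an arc $a=uv$, $u$ is its tail and $v$ its head. The line digraph $L(D)$ has vertex set $A(D)$, with an arc $xy$ iff the head of $x$ equals the tail of $y$; $L^1(D)=L(D)$, $L^{m+1}(D)=L(L^m(D))$. For integers $\alpha>0$, $k>1$, an $(\alpha,k)$-labeling of $D=(V,A)$ assigns to each vertex $x$ a string $(l_1(x),\dots,l_k(x))$ with entries in $\{1,\dots,\alpha\}$, distinct vertices getting distinct strings, such that for all vertices $x,y$: $xy\in A$ iff $l_i(x)=l_{i-1}(y)$ for all $i\in\{2,\dots,k\}$. A DNA graph is a digraph admitting a $(4,k)$-labeling for some integer $k>1$. The windmill digraph $D_n^3$ is obtained from three otherwise vertex-disjoint directed cycles of length $n$ by identifying one vertex from each of them into a single common vertex. -}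

module Defs where

open import Data.Nat using (ℕ; zero; suc; _∸_; _<_)
open import Data.Fin using (Fin; toℕ)
open import Data.Maybe using (Maybe; just; nothing)
open import Data.Product using (Σ; _×_; _,_; proj₁; proj₂)
open import Data.Empty using (⊥)
open import Relation.Binary.PropositionalEquality using (_≡_)

-- A digraph: a vertex type and an arc relation (Arc u v = "uv is an arc").
-- All digraphs we build have proof-irrelevant arc relations (no multiple arcs).
record Digraph : Set₁ where
  field
    V   : Set
    Arc : V → V → Set
open Digraph public

head tail : (D : Digraph) → Σ (V D) (λ u → Σ (V D) (λ v → Arc D u v)) → V D
head D (u , v , _) = v
tail D (u , v , _) = u

L : Digraph → Digraph
L D = record
  { V   = Σ (V D) (λ u → Σ (V D) (λ v → Arc D u v))
  ; Arc = λ x y → head D x ≡ tail D y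
  }

L^ : ℕ → Digraph → Digraph
L^ zero    D = D
L^ (suc m) D = L (L^ m D)

-- Windmill digraph D_n^3: a common vertex (nothing) and, for each cycle c : Fin 3,
-- the n-1 further vertices (just (c , i)), i = 0..n-2, with arcs
-- centre → (c,0) → (c,1) → … → (c,n-2) → centre.
WV : ℕ → Set
WV n = Maybe (Fin 3 × Fin (n ∸ 1))

WArc : (n : ℕ) → WV n → WV n → Set
WArc n nothing        nothing        = ⊥
WArc n nothing        (just (c , i)) = toℕ i ≡ 0
WArc n (just (c , i)) nothing        = suc (toℕ i) ≡ n ∸ 1
WArc n (just (c , i)) (just (d , j)) = (c ≡ d) × (suc (toℕ i) ≡ toℕ j)

Windmill : ℕ → Digraph
Windmill n = record { V = WV n ; Arc = WArc n }

-- (α,k)-labeling: strings are functions Fin k → Fin α (position i+1 of the paper is i here).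
-- Condition: xy arc iff l_i(x) = l_{i-1}(y) for all positions i ≥ 2.
Shift : {α k : ℕ} → (Fin k → Fin α) → (Fin k → Fin α) → Set
Shift {k = k} s t = (i j : Fin k) → toℕ i ≡ suc (toℕ j) → s i ≡ t j

record Labeling (α k : ℕ) (D : Digraph) : Set where
  field
    label     : V D → Fin k → Fin α
    injective : ∀ x y → (∀ i → label x i ≡ label y i) → x ≡ y
    arc⇒shift : ∀ x y → Arc D x y → Shift (label x) (label y)
    shift⇒arc : ∀ x y → Shift (label x) (label y) → Arc D x y

IsDNA : Digraph → Set
IsDNA D = Σ ℕ (λ k → (1 < k) × Labeling 4 k D)

module Submission where

-- Number the arcs of each petal (directed n-cycle) of the windmill
-- D_n^3 by their distance e ∈ {0,…,n-1} from the centre.  An arc at distance e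
-- on petal c receives the "one-hot" string of length n that is the blank letter 0
-- everywhere except for the letter c+1 at position n-1-e.  Shifting such a string
-- one step to the left moves the mark one place, which is exactly the passage to
-- the next arc of the same petal; the last arc of a petal (mark at position 0)
-- shifts to the blank word, which is compatible with the first arc of every
-- petal.  Hence L(D_n^3) has a (4,n)-labeling.  Next, an (α,k)-labeling l of a
-- digraph D with at most one arc between any two vertices yields the
-- (α,k+1)-labeling uv ↦ l(u)·(last letter of l(v)) of L(D); iterating gives a
-- (4,n+m-1)-labeling of L^m(D_n^3) for every m ≥ 1.

open import Defs
open import Axiom.UniquenessOfIdentityProofs.WithK using (uip)
open import Data.Nat using (ℕ; zero; suc; _+_; _≤_; _<_; z≤n; s≤s; _≟_)
open import Data.Nat.Properties
  using (+-suc; +-cancelˡ-≡; m∸n+n≡m; m≤n+m; ≤-trans; <-irrefl; m≢1+n+m; +-identityʳ)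
  renaming (suc-injective to ℕ-suc-injective)
open import Data.Fin using (Fin; toℕ; inject₁; opposite; lower₁)
  renaming (zero to fzero; suc to fsuc)
open import Data.Fin.Properties
  using (toℕ-injective; toℕ<n; toℕ-inject₁; toℕ-lower₁; opposite-prop; suc-injective)
open import Data.Maybe using (just; nothing)
open import Data.Product using (_×_; _,_)
open import Data.Sum using (_⊎_; inj₁; inj₂)
open import Data.Empty using (⊥-elim)
open import Relation.Nullary using (¬_; yes; no)
open import Relation.Binary.PropositionalEquality

shift-at : ∀ {α k} {s t : Fin (suc k) → Fin α} → Shift s t → ∀ i → s (fsuc i) ≡ t (inject₁ i)
shift-at sh i = sh (fsuc i) (inject₁ i) (cong suc (sym (toℕ-inject₁ i)))

opposite-+suc : ∀ {n} (i : Fin n) → toℕ (opposite i) + suc (toℕ i) ≡ n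
opposite-+suc i = trans (cong (_+ suc (toℕ i)) (opposite-prop i)) (m∸n+n≡m (toℕ<n i))

opposite-+ : ∀ {n} (i : Fin (suc n)) → toℕ (opposite i) + toℕ i ≡ n
opposite-+ i = ℕ-suc-injective (trans (sym (+-suc (toℕ (opposite i)) (toℕ i))) (opposite-+suc i))

record Embedding (D E : Digraph) : Set where
  field
    map       : V D → V E
    injective : ∀ x y → map x ≡ map y → x ≡ y
    arc⇒      : ∀ x y → Arc D x y → Arc E (map x) (map y)
    arc⇐      : ∀ x y → Arc E (map x) (map y) → Arc D x y

pullback : ∀ {α k D E} → Embedding D E → Labeling α k E → Labeling α k D
pullback f lab = record
  { label     = λ x → label (map x)
  ; injective = λ x y eq → Embedding.injective f x y (injective (map x) (map y) eq)
  ; arc⇒shift = λ x y a → arc⇒shift (map x) (map y) (arc⇒ x y a)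
  ; shift⇒arc = λ x y sh → arc⇐ x y (shift⇒arc (map x) (map y) sh)
  }
  where
  open Embedding f using (map; arc⇒; arc⇐)
  open Labeling lab

module OneHot (M α : ℕ) where

  Position : Set
  Position = Fin (suc M)

  mark : ℕ → Fin α → Fin (suc α)
  mark s c with s ≟ M
  ... | yes _ = fsuc c
  ... | no  _ = fzero

  hot : Position → Fin α → Position → Fin (suc α)
  hot e c p = mark (toℕ p + toℕ e) c

  mark-on : ∀ {s} c → s ≡ M → mark s c ≡ fsuc c
  mark-on {s} c s≡M with s ≟ M
  ... | yes _   = refl
  ... | no  s≢M = ⊥-elim (s≢M s≡M)

  mark-off : ∀ {s} c → ¬ s ≡ M → mark s c ≡ fzero
  mark-off {s} c s≢M with s ≟ M
  ... | yes s≡M = ⊥-elim (s≢M s≡M)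
  ... | no  _   = refl

  mark-inv : ∀ {s} c c' → mark s c ≡ fsuc c' → (s ≡ M) × (c ≡ c')
  mark-inv {s} c c' eq with s ≟ M
  mark-inv {s} c c' eq | yes s≡M = s≡M , suc-injective eq
  mark-inv {s} c c' () | no  _

  hot-injective : ∀ e e' c c' → (∀ p → hot e c p ≡ hot e' c' p) → (e ≡ e') × (c ≡ c')
  hot-injective e e' c c' eq with mark-inv c' c (trans (sym (eq p)) (mark-on c (opposite-+ e)))
    where p = opposite e
  ... | p+e'≡M , c'≡c =
    toℕ-injective (+-cancelˡ-≡ (toℕ (opposite e)) _ _ (trans (opposite-+ e) (sym p+e'≡M))) , sym c'≡c

  -- The successor relation on (distance, colour): one step further on the
  -- same petal, or from the last arc of a petal to the first arc of any petal.
  Next : Position × Fin α → Position × Fin α → Set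
  Next (e , c) (e' , c') = ((toℕ e' ≡ suc (toℕ e)) × (c ≡ c')) ⊎ ((toℕ e ≡ M) × (toℕ e' ≡ 0))

  next⇒shift : ∀ e e' c c' → Next (e , c) (e' , c') → Shift (hot e c) (hot e' c')
  next⇒shift e e' c .c (inj₁ (e'≡1+e , refl)) i j i≡1+j = cong (λ s → mark s c) (begin
    toℕ i + toℕ e         ≡⟨ cong (_+ toℕ e) i≡1+j ⟩
    suc (toℕ j + toℕ e)   ≡⟨ sym (+-suc (toℕ j) (toℕ e)) ⟩
    toℕ j + suc (toℕ e)   ≡⟨ cong (toℕ j +_) (sym e'≡1+e) ⟩
    toℕ j + toℕ e'        ∎)
    where open ≡-Reasoning
  next⇒shift e e' c c' (inj₂ (e≡M , e'≡0)) i j i≡1+j =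
    trans (mark-off c past-end) (sym (mark-off c' before-end))
    where
    -- The mark of hot e c sits at position 0, so position j+1 is blank …
    past-end : ¬ toℕ i + toℕ e ≡ M
    past-end eq = m≢1+n+m M (sym (trans (cong₂ _+_ (sym i≡1+j) (sym e≡M)) eq))
    -- … and the mark of hot e' c' sits at position M, beyond position j.
    before-end : ¬ toℕ j + toℕ e' ≡ M
    before-end eq = <-irrefl refl (subst (_< suc M) i≡M (toℕ<n i))
      where i≡M = trans i≡1+j (cong suc (trans (sym (+-identityʳ (toℕ j)))
                                                (trans (cong (toℕ j +_) (sym e'≡0)) eq)))

  shift⇒next : ∀ e e' c c' → Shift (hot e c) (hot e' c') → Next (e , c) (e' , c')
  shift⇒next e e' c c' sh with toℕ e ≟ M
  ... | yes e≡M = inj₂ (e≡M , restart e' sh)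
    where
    -- After the last arc of a petal only a first arc can follow: otherwise the
    -- mark of hot e' c' would be matched against a blank letter of hot e c.
    restart : ∀ e' → Shift (hot e c) (hot e' c') → toℕ e' ≡ 0
    restart fzero      _  = refl
    restart (fsuc e'') sh = ⊥-elim (fzero≢fsuc (trans (sym blank) (trans (shift-at sh p) marked)))
      where
      p = opposite e''
      fzero≢fsuc : ¬ fzero ≡ fsuc c'
      fzero≢fsuc ()
      blank : hot e c (fsuc p) ≡ fzero
      blank = mark-off c (λ eq → m≢1+n+m M (sym (trans (cong (suc (toℕ p) +_) (sym e≡M)) eq)))
      marked : hot (fsuc e'') c' (inject₁ p) ≡ fsuc c'
      marked = mark-on c' (trans (cong (_+ suc (toℕ e'')) (toℕ-inject₁ p)) (opposite-+suc e''))
  ... | no e≢M = inj₁ (advance (mark-inv c' c (trans (sym (shift-at sh p)) marked)))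
    where
    -- Otherwise the mark of hot e c sits at a position p+1; the shift moves it
    -- to position p of hot e' c', so e' = e + 1 and the colour is kept.
    p = opposite (lower₁ e (λ eq → e≢M (sym eq)))
    p+1+e≡M : toℕ p + suc (toℕ e) ≡ M
    p+1+e≡M = subst (λ t → toℕ p + suc t ≡ M) (toℕ-lower₁ e _) (opposite-+suc (lower₁ e _))
    marked : hot e c (fsuc p) ≡ fsuc c
    marked = mark-on c (trans (sym (+-suc (toℕ p) (toℕ e))) p+1+e≡M)
    advance : (toℕ (inject₁ p) + toℕ e' ≡ M) × (c' ≡ c) → (toℕ e' ≡ suc (toℕ e)) × (c ≡ c')
    advance (p+e'≡M , c'≡c) =
      +-cancelˡ-≡ (toℕ p) _ _ (trans (cong (_+ toℕ e') (sym (toℕ-inject₁ p))) (trans p+e'≡M (sym p+1+e≡M)))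
      , sym c'≡c

  Rotor : Digraph
  Rotor = record { V = Position × Fin α ; Arc = Next }

  rotor-labeling : Labeling (suc α) (suc M) Rotor
  rotor-labeling = record
    { label     = λ { (e , c) → hot e c }
    ; injective = λ { (e , c) (e' , c') eq → same (hot-injective e e' c c' eq) }
    ; arc⇒shift = λ { (e , c) (e' , c') → next⇒shift e e' c c' }
    ; shift⇒arc = λ { (e , c) (e' , c') → shift⇒next e e' c c' }
    }
    where
    same : ∀ {e e' : Position} {c c' : Fin α} → (e ≡ e') × (c ≡ c') → (e , c) ≡ (e' , c')
    same (refl , refl) = refl

-- (3) The line digraph of the windmill D_{M+1}^3 is isomorphic to the rotor
-- digraph with M+1 distances and 3 colours: an arc is determined by its
-- distance from the centre along its petal and by the petal it lies on.

module WindmillArcs (M : ℕ) where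
  open OneHot M 3 using (Position; Rotor)

  W : Digraph
  W = Windmill (suc M)

  distance : V (L W) → Position
  distance (nothing       , _ , _) = fzero
  distance (just (_ , i) , _ , _) = fsuc i

  petal : V (L W) → Fin 3
  petal (nothing , just (c , _) , _) = c
  petal (nothing , nothing , ())
  petal (just (c , _) , _ , _)       = c

  out-unique : ∀ c i v v' (a : WArc (suc M) (just (c , i)) v) (a' : WArc (suc M) (just (c , i)) v') →
               _≡_ {A = V (L W)} (just (c , i) , v , a) (just (c , i) , v' , a')
  out-unique c i nothing nothing a a' = cong (λ b → (just (c , i) , nothing , b)) (uip a a')
  out-unique c i nothing (just (_ , j)) a (_ , a2) = ⊥-elim (<-irrefl (trans (sym a2) a) (toℕ<n j))
  out-unique c i (just (_ , j)) nothing (_ , a2) a' = ⊥-elim (<-irrefl (trans (sym a2) a') (toℕ<n j))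
  out-unique c i (just (.c , j)) (just (.c , j')) (refl , a2) (refl , a2')
    with toℕ-injective (trans (sym a2) a2')
  ... | refl = cong (λ b → (just (c , i) , just (c , j) , (refl , b))) (uip a2 a2')

  locate : V (L W) → Position × Fin 3
  locate x = distance x , petal x

  locate-injective : ∀ x y → locate x ≡ locate y → x ≡ y
  locate-injective (nothing , nothing , ()) _ _
  locate-injective (nothing , just _ , _) (nothing , nothing , ()) _
  locate-injective (nothing , just (c , i) , a) (nothing , just (.c , i') , a') refl
    with toℕ-injective (trans a (sym a'))
  ... | refl = cong (λ b → (nothing , just (c , i) , b)) (uip a a')
  locate-injective (just (c , i) , v , a) (just (.c , .i) , v' , a') refl = out-unique c i v v' a a'

  locate-arc⇒ : ∀ x y → Arc (L W) x y → Arc Rotor (locate x) (locate y)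
  locate-arc⇒ (u , v , a) (.v , w , b) refl = consecutive u v w a b
    where
    consecutive : ∀ u v w (a : WArc (suc M) u v) (b : WArc (suc M) v w) →
                  Arc Rotor (locate (u , v , a)) (locate (v , w , b))
    consecutive nothing nothing _ () _
    consecutive nothing (just _) _ a _ = inj₁ (cong suc a , refl)
    consecutive (just _) nothing nothing _ ()
    consecutive (just _) nothing (just _) a _ = inj₂ (a , refl)
    consecutive (just _) (just _) _ (refl , a2) _ = inj₁ (cong suc (sym a2) , refl)

  locate-arc⇐ : ∀ x y → Arc Rotor (locate x) (locate y) → Arc (L W) x y
  locate-arc⇐ (nothing , nothing , ()) _ _
  locate-arc⇐ (nothing , just _ , _) (nothing , _ , _) (inj₁ (() , _))
  locate-arc⇐ (nothing , just (_ , j) , a) _ (inj₂ (0≡M , _)) =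
    ⊥-elim (<-irrefl (trans a 0≡M) (toℕ<n j))
  locate-arc⇐ (nothing , just (c , j) , a) (just (.c , i') , _ , _) (inj₁ (e'≡1 , refl))
    with toℕ-injective (trans a (sym (ℕ-suc-injective e'≡1)))
  ... | refl = refl
  locate-arc⇐ (just _ , nothing , _) (nothing , _ , _) _ = refl
  locate-arc⇐ (just _ , nothing , a) (just (_ , i') , _ , _) (inj₁ (e'≡1+e , _)) =
    ⊥-elim (<-irrefl (trans (ℕ-suc-injective e'≡1+e) a) (toℕ<n i'))
  locate-arc⇐ (just _ , nothing , _) (just _ , _ , _) (inj₂ (_ , ()))
  locate-arc⇐ (just _ , just (_ , j) , _) (nothing , _ , _) (inj₁ (() , _))
  locate-arc⇐ (just _ , just (_ , j) , (_ , a2)) _ (inj₂ (e≡M , _)) =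
    ⊥-elim (<-irrefl (trans (sym a2) e≡M) (toℕ<n j))
  locate-arc⇐ (just (c , _) , just (.c , j) , (refl , a2)) (just (.c , i') , _ , _) (inj₁ (e'≡1+e , refl))
    with toℕ-injective (trans (sym a2) (sym (ℕ-suc-injective e'≡1+e)))
  ... | refl = refl

  locate-embedding : Embedding (L W) Rotor
  locate-embedding = record
    { map = locate ; injective = locate-injective ; arc⇒ = locate-arc⇒ ; arc⇐ = locate-arc⇐ }

  windmill-line-labeling : Labeling 4 (suc M) (L W)
  windmill-line-labeling = pullback locate-embedding (OneHot.rotor-labeling M 3)

-- If D has no parallel arcs, an
-- (α,k+1)-labeling l of D gives the (α,k+2)-labeling of L(D) that sends the
-- arc uv to l(u) followed by the last letter of l(v); since l(u) shifts to
-- l(v), this string also equals the first letter of l(u) followed by l(v).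

ArcIrrelevant : Digraph → Set
ArcIrrelevant D = ∀ {u v} (a b : Arc D u v) → a ≡ b

module LineLift {α k : ℕ} (D : Digraph) (irrelevant : ArcIrrelevant D)
                (lab : Labeling α (suc k) D) where
  open Labeling lab

  arc-label : V (L D) → Fin (suc (suc k)) → Fin α
  arc-label (u , v , _) fzero    = label u fzero
  arc-label (u , v , _) (fsuc i) = label v i

  tail-prefix : ∀ u v (a : Arc D u v) i → label u i ≡ arc-label (u , v , a) (inject₁ i)
  tail-prefix u v a fzero    = refl
  tail-prefix u v a (fsuc i) = shift-at (arc⇒shift u v a) i

  arc-label-injective : ∀ x y → (∀ i → arc-label x i ≡ arc-label y i) → x ≡ y
  arc-label-injective (u , v , a) (u' , v' , a') eq
    with injective v v' (λ i → eq (fsuc i))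
       | injective u u' (λ i → trans (tail-prefix u v a i)
                              (trans (eq (inject₁ i)) (sym (tail-prefix u' v' a' i))))
  ... | refl | refl = cong (λ b → (u , v , b)) (irrelevant a a')

  arc⇒arc-shift : ∀ x y → Arc (L D) x y → Shift (arc-label x) (arc-label y)
  arc⇒arc-shift (u , v , a) (.v , w , b) refl fzero    _        ()
  arc⇒arc-shift (u , v , a) (.v , w , b) refl (fsuc i) fzero    i≡1 =
    cong (label v) (toℕ-injective (ℕ-suc-injective i≡1))
  arc⇒arc-shift (u , v , a) (.v , w , b) refl (fsuc i) (fsuc j) i≡1+j =
    arc⇒shift v w b i j (ℕ-suc-injective i≡1+j)

  arc-shift⇒arc : ∀ x y → Shift (arc-label x) (arc-label y) → Arc (L D) x y
  arc-shift⇒arc (u , v , a) (u' , v' , a') sh =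
    injective v u' (λ i → trans (shift-at sh i) (sym (tail-prefix u' v' a' i)))

  line-labeling : Labeling α (suc (suc k)) (L D)
  line-labeling = record
    { label     = arc-label
    ; injective = arc-label-injective
    ; arc⇒shift = arc⇒arc-shift
    ; shift⇒arc = arc-shift⇒arc
    }

-- Line digraphs never have parallel arcs, so lifting can be iterated: an
-- (α,k+1)-labeling of L(D) yields an (α,k+m+1)-labeling of L^{m+1}(D).
iterated-line-labeling : ∀ {α k} (D : Digraph) → Labeling α (suc k) (L D) →
                         (m : ℕ) → Labeling α (suc (m + k)) (L^ (suc m) D)
iterated-line-labeling D lab zero    = lab
iterated-line-labeling D lab (suc m) =
  LineLift.line-labeling (L^ (suc m) D) uip (iterated-line-labeling D lab m)

theorem9 : (n m : ℕ) → 3 ≤ n → 1 ≤ m → IsDNA (L^ m (Windmill n))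
theorem9 (suc M) (suc m) (s≤s 2≤M) _ =
  suc (m + M) , s≤s (≤-trans (≤-trans (s≤s z≤n) 2≤M) (m≤n+m M m)) , labeling
  where
  labeling : Labeling 4 (suc (m + M)) (L^ (suc m) (Windmill (suc M)))
  labeling = iterated-line-labeling (Windmill (suc M)) (WindmillArcs.windmill-line-labeling M) m
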